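{- Let $k_0 < k_1'$ be positive integers and let $G$ be a graph with property (P) (defined in the context). Then the set of low-degree vertices $v$ of $G$ such that either (i) $v$ has no high-degree neighbor, or (ii) $v$ has exactly one high-degree neighbor $w$, $d(w) = k_1'$, and $N(v) \cap N(w) \neq \varnothing$, forms a clique.
   Context: Graphs are finite and simple. Given integers $k_0 < k_1'$, a graph $G$ has property (P) if for every pair of nonadjacent vertices $x,y$ of $G$ with $d(x),d(y) \leq k_0$, there exists either $z \in N(x)$ with $|N(z) \setminus (N(x) \cup \{y\})| \geq k_1'$ or $z' \in N(y)$ with $|N(z') \setminus (N(y) \cup \{x\})| \geq k_1'$. A vertex is high-degree if its degree is at least $k_1'$ and low-degree if its degree is at most $k_0$. -}

module Defs where

open import Data.Nat using (ℕ; _≤_; _<_; _≥_)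
open import Data.Bool using (Bool; true; false)
open import Data.Fin using (Fin)
open import Data.Fin.Subset using (Subset; ∣_∣; _─_; _∪_; ⁅_⁆; _∩_; Nonempty)
open import Data.Vec using (tabulate)
open import Data.Product using (Σ; _×_; _,_; ∃)
open import Data.Sum using (_⊎_)
open import Relation.Nullary using (¬_)
open import Relation.Binary.PropositionalEquality using (_≡_)

record Graph (n : ℕ) : Set where
  field
    adj   : Fin n → Fin n → Bool
    sym   : ∀ u v → adj u v ≡ adj v u
    irrefl : ∀ v → adj v v ≡ false
open Graph public

module _ {n : ℕ} (G : Graph n) where

  Adj : Fin n → Fin n → Set
  Adj u v = adj G u v ≡ true

  N : Fin n → Subset n
  N v = tabulate (adj G v)

  deg : Fin n → ℕ
  deg v = ∣ N v ∣

  PropertyP : ℕ → ℕ → Set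
  PropertyP k₀ k₁' =
    ∀ x y → ¬ (x ≡ y) → ¬ Adj x y → deg x ≤ k₀ → deg y ≤ k₀ →
      (Σ (Fin n) λ z → Adj x z × k₁' ≤ ∣ N z ─ (N x ∪ ⁅ y ⁆) ∣)
      ⊎ (Σ (Fin n) λ z' → Adj y z' × k₁' ≤ ∣ N z' ─ (N y ∪ ⁅ x ⁆) ∣)

  HighDeg : ℕ → Fin n → Set
  HighDeg k₁' v = k₁' ≤ deg v

  LowDeg : ℕ → Fin n → Set
  LowDeg k₀ v = deg v ≤ k₀

  InS : ℕ → ℕ → Fin n → Set
  InS k₀ k₁' v =
    LowDeg k₀ v ×
    ( (∀ w → Adj v w → ¬ HighDeg k₁' w)
    ⊎ (Σ (Fin n) λ w → Adj v w × HighDeg k₁' w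
         × (∀ w' → Adj v w' → HighDeg k₁' w' → w' ≡ w)
         × deg w ≡ k₁'
         × Nonempty (N v ∩ N w)))

  IsClique : (Fin n → Set) → Set
  IsClique S = ∀ u v → S u → S v → ¬ (u ≡ v) → Adj u v

{-# OPTIONS --safe #-}
module Submission where

-- A vertex v of S can never be the vertex that property (P) points to: a
-- neighbour z of v of degree below k₁' is too small, and the only neighbour
-- of degree at least k₁' is the vertex w of (ii), which has exactly k₁'
-- neighbours, at least one of them in N(v), so fewer than k₁' outside N(v).
-- Hence two nonadjacent vertices of S would contradict (P).

open import Defs
open import Data.Nat using (ℕ; _<_; _≤_; _≤?_)
open import Data.Nat.Properties using (≤-<-trans; ≰⇒>; <⇒≱; module ≤-Reasoning)
open import Data.Bool using (true; _≟_)
open import Data.Fin.Subset using (Subset; ∣_∣; _─_; _∪_; _∩_; ⁅_⁆; _⊆_; Nonempty)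
open import Data.Fin.Subset.Properties
  using (x∈p∩q⁻; x∈p∩q⁺; p⊆p∪q; ∣p─q∣≤∣p∣; p∩q≢∅⇒∣p─q∣<∣p∣)
open import Data.Product using (_,_; proj₁)
open import Data.Sum using (inj₁; inj₂)
open import Relation.Nullary using (yes; no; contradiction)
open import Relation.Binary.PropositionalEquality using (refl)

p∩q≢∅∧p⊆r⇒q∩r≢∅ : ∀ {n} {p q r : Subset n} → Nonempty (p ∩ q) → p ⊆ r → Nonempty (q ∩ r)
p∩q≢∅∧p⊆r⇒q∩r≢∅ {p = p} {q} (x , x∈p∩q) p⊆r =
  let x∈p , x∈q = x∈p∩q⁻ p q x∈p∩q in x , x∈p∩q⁺ (x∈q , p⊆r x∈p)

module _ {n : ℕ} (G : Graph n) {k₀ k₁' : ℕ} where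

  InS⇒neighbour-escape<k₁' : ∀ {v y z} → InS G k₀ k₁' v → Adj G v z →
                             ∣ N G z ─ (N G v ∪ ⁅ y ⁆) ∣ < k₁'
  InS⇒neighbour-escape<k₁' {v} {y} {z} (_ , few-high) vz with k₁' ≤? deg G z
  ... | no z-low = ≤-<-trans (∣p─q∣≤∣p∣ (N G z) _) (≰⇒> z-low)
  ... | yes z-high with few-high
  ...   | inj₁ no-high = contradiction z-high (no-high z vz)
  ...   | inj₂ (w , _ , _ , unique , deg-w≡k₁' , common) with unique z vz z-high
  ...     | refl = begin-strict
    ∣ N G z ─ (N G v ∪ ⁅ y ⁆) ∣  <⟨ p∩q≢∅⇒∣p─q∣<∣p∣ (N G z) _ meets ⟩
    deg G z                      ≡⟨ deg-w≡k₁' ⟩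
    k₁'                          ∎
    where
      open ≤-Reasoning
      meets : Nonempty (N G z ∩ (N G v ∪ ⁅ y ⁆))
      meets = p∩q≢∅∧p⊆r⇒q∩r≢∅ common (p⊆p∪q ⁅ y ⁆)

proposition3p1 : (k₀ k₁' : ℕ) → 1 ≤ k₀ → k₀ < k₁' → (n : ℕ) → (G : Graph n) →
    PropertyP G k₀ k₁' → IsClique G (InS G k₀ k₁')
proposition3p1 k₀ k₁' _ _ n G P u v Su Sv u≢v with adj G u v ≟ true
... | yes uv = uv
... | no ¬uv with P u v u≢v ¬uv (proj₁ Su) (proj₁ Sv)
... | inj₁ (z , uz , big) = contradiction big (<⇒≱ (InS⇒neighbour-escape<k₁' G Su uz))
... | inj₂ (z , vz , big) = contradiction big (<⇒≱ (InS⇒neighbour-escape<k₁' G Sv vz))
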